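{- Let $G = H \,\Box\, B$ be the Cartesian product of a finite graph $H$ and a finite bipartite graph $B$. Suppose $H$ has maximal matchings $N^\bullet$ and $N^\circ$ with $|N^\bullet| = |N^\circ|$ such that every vertex of $H$ is covered by $N^\bullet$ or by $N^\circ$. Then $G$ has maximal matchings $M^\bullet$ and $M^\circ$ with $|M^\bullet| = |M^\circ| = |N^\bullet|\cdot|V(B)|$ such that every vertex of $G$ is covered by $M^\bullet$ or by $M^\circ$.
   Context: The Cartesian product $H\,\Box\,B$ has vertex set $V(H)\times V(B)$, with $(u,v)$ adjacent to $(u',v')$ iff either $u=u'$ and $vv'\in E(B)$, or $v=v'$ and $uu'\in E(H)$. A matching is a set of pairwise vertex-disjoint edges; it is maximal if maximal with respect to inclusion; a vertex is covered by a matching if it is an endpoint of one of its edges. -}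

module Defs where

open import Data.Nat using (ℕ; _*_)
open import Data.Fin using (Fin; combine)
open import Data.List using (List; length; lookup)
open import Data.Product using (Σ; _×_; _,_; ∃-syntax)
open import Data.Sum using (_⊎_)
open import Relation.Binary.PropositionalEquality using (_≡_; _≢_)
open import Relation.Nullary using (¬_)
open import Data.Bool using (Bool)

record Graph : Set₁ where
  field
    n   : ℕ
    Adj : Fin n → Fin n → Set
open Graph public

record IsSimple (G : Graph) : Set where
  field
    sym   : ∀ {u v} → Adj G u v → Adj G v u
    irrefl : ∀ {u} → ¬ Adj G u u

IsBipartite : Graph → Set
IsBipartite G = Σ (Fin (n G) → Bool) λ c → ∀ {u v} → Adj G u v → c u ≢ c v

-- Cartesian product H □ B; vertex (u , v) is encoded as  combine u v : Fin (n H * n B)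
-- (combine is a bijection Fin m × Fin k ≅ Fin (m * k)).
data ProdAdj (H B : Graph) : Fin (n H * n B) → Fin (n H * n B) → Set where
  inB : ∀ (u : Fin (n H)) {v v' : Fin (n B)} → Adj B v v' → ProdAdj H B (combine u v) (combine u v')
  inH : ∀ {u u' : Fin (n H)} (v : Fin (n B)) → Adj H u u' → ProdAdj H B (combine u v) (combine u' v)

_□_ : Graph → Graph → Graph
H □ B = record { n = n H * n B ; Adj = ProdAdj H B }

-- An (oriented representative of an) edge of G.
Edge : Graph → Set
Edge G = Σ (Fin (n G)) λ u → Σ (Fin (n G)) λ v → Adj G u v

fst : ∀ {G} → Edge G → Fin (n G)
fst (u , _ , _) = u
snd : ∀ {G} → Edge G → Fin (n G)
snd (_ , v , _) = v

_∈ₑ_ : ∀ {G} → Fin (n G) → Edge G → Set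
x ∈ₑ e = x ≡ fst e ⊎ x ≡ snd e

-- A matching is a list of edges whose entries (at distinct positions) are
-- pairwise vertex-disjoint; its size is the length of the list.
IsMatching : (G : Graph) → List (Edge G) → Set
IsMatching G M = ∀ (i j : Fin (length M)) → i ≢ j →
  ∀ x → x ∈ₑ lookup M i → ¬ (x ∈ₑ lookup M j)

InM : ∀ {G} → List (Edge G) → Fin (n G) → Fin (n G) → Set
InM M u v = ∃[ i ] ((fst (lookup M i) ≡ u × snd (lookup M i) ≡ v)
                  ⊎ (fst (lookup M i) ≡ v × snd (lookup M i) ≡ u))

IsMaximalMatching : (G : Graph) → List (Edge G) → Set
IsMaximalMatching G M = IsMatching G M ×
  (∀ (M' : List (Edge G)) → IsMatching G M' →
     (∀ u v → InM {G} M u v → InM {G} M' u v) →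
     (∀ u v → InM {G} M' u v → InM {G} M u v))

Covered : ∀ {G} → List (Edge G) → Fin (n G) → Set
Covered M x = ∃[ i ] (x ∈ₑ lookup M i)

{-# OPTIONS --safe #-}
-- A matching is maximal exactly when the vertices it covers form a vertex cover.  Properly
-- 2-colour B and put N● into the copy of H over each black vertex of B and N○ into the copy
-- over each white one (the other way round for M○).  The copies are vertex-disjoint, so this
-- is a matching with |N●|·|V(B)| edges.  An edge inside a copy has a covered end because the
-- matching placed there is maximal in H; an edge (u,v)(u,v′) joins copies of opposite colours,
-- one carrying N● and the other N○, and u is covered by one of them.  The same observation at
-- a single vertex (u,v) shows that M● and M○ together cover G.
module Submission where

open import Defs
open import Data.Bool using (Bool; true; false; if_then_else_)
open import Data.Empty using (⊥-elim)
open import Data.Fin using (Fin; zero; suc; combine; remQuot)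
open import Data.Fin.Properties using (combine-injective; combine-remQuot; suc-injective; _≟_)
open import Data.List using (List; []; _∷_; length; lookup; map; concat; tabulate)
open import Data.List.Properties using (length-++; length-map)
open import Data.List.Membership.Propositional using (_∈_; lose)
open import Data.List.Membership.Propositional.Properties using (∈-lookup)
open import Data.List.Relation.Unary.All as All using (All; []; _∷_)
import Data.List.Relation.Unary.All.Properties as All
open import Data.List.Relation.Unary.Any as Any using (Any)
import Data.List.Relation.Unary.Any.Properties as Any
open import Data.List.Relation.Unary.AllPairs as AllPairs using (AllPairs; []; _∷_)
import Data.List.Relation.Unary.AllPairs.Properties as AllPairs
open import Data.Nat using (zero; suc; _*_; _+_)
open import Data.Nat.Properties using (*-comm)
open import Data.Product using (Σ; _×_; _,_; ∃-syntax; proj₁; proj₂)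
open import Data.Sum as Sum using (_⊎_; inj₁; inj₂)
open import Function using (_∘_; id)
open import Relation.Binary.PropositionalEquality using (_≡_; _≢_; refl; sym; trans; cong; cong₂; subst)
open import Relation.Nullary using (¬_; Dec; yes; no)
open import Relation.Nullary.Decidable using (decidable-stable; _⊎-dec_)

IsVertexCover : (G : Graph) → (Fin (n G) → Set) → Set
IsVertexCover G S = ∀ {a b} → Adj G a b → S a ⊎ S b

module _ {G : Graph} where

  Covers : List (Edge G) → Fin (n G) → Set
  Covers M x = Any (_∈ₑ_ {G} x) M

  Covered⇒Covers : ∀ {M x} → Covered {G} M x → Covers M x
  Covered⇒Covers {M} (i , x∈Mᵢ) = lose (∈-lookup {xs = M} i) x∈Mᵢ

  Covers⇒Covered : ∀ {M x} → Covers M x → Covered {G} M x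
  Covers⇒Covered x∈V = Any.index x∈V , Any.lookup-index x∈V

  covers? : ∀ M x → Dec (Covers M x)
  covers? M x = Any.any? (λ e → (x ≟ fst {G} e) ⊎-dec (x ≟ snd {G} e)) M

  Disjoint : Edge G → Edge G → Set
  Disjoint e f = ∀ x → _∈ₑ_ {G} x e → ¬ _∈ₑ_ {G} x f

  Disjoint-sym : ∀ {e f} → Disjoint e f → Disjoint f e
  Disjoint-sym e#f x x∈f x∈e = e#f x x∈e x∈f

  AllPairs⇒IsMatching : ∀ {M} → AllPairs Disjoint M → IsMatching G M
  AllPairs⇒IsMatching         (_   ∷ _)  zero    zero    i≢j = ⊥-elim (i≢j refl)
  AllPairs⇒IsMatching         (e#M ∷ _)  zero    (suc j) _   = All.lookup e#M (∈-lookup j)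
  AllPairs⇒IsMatching {e ∷ M} (e#M ∷ _)  (suc i) zero    _   =
    Disjoint-sym {e} {lookup M i} (All.lookup e#M (∈-lookup i))
  AllPairs⇒IsMatching         (_   ∷ M!) (suc i) (suc j) i≢j =
    AllPairs⇒IsMatching M! i j (i≢j ∘ cong suc)

  IsMatching⇒AllPairs : ∀ {M} → IsMatching G M → AllPairs Disjoint M
  IsMatching⇒AllPairs {[]}    _        = []
  IsMatching⇒AllPairs {e ∷ M} matching =
    All.tabulate e#f ∷
    IsMatching⇒AllPairs (λ i j i≢j → matching (suc i) (suc j) (i≢j ∘ suc-injective))
    where
    e#f : ∀ {f} → f ∈ M → Disjoint e f
    e#f f∈M =
      subst (Disjoint e) (sym (Any.lookup-index f∈M)) (matching zero (suc (Any.index f∈M)) λ ())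

  shared-endpoint⇒same-index : ∀ {M} → IsMatching G M → ∀ {i j x} →
    _∈ₑ_ {G} x (lookup M i) → _∈ₑ_ {G} x (lookup M j) → i ≡ j
  shared-endpoint⇒same-index matching {i} {j} {x} x∈Mᵢ x∈Mⱼ =
    decidable-stable (i ≟ j) (λ i≢j → matching i j i≢j x x∈Mᵢ x∈Mⱼ)

  -- InM M u v unfolds to ∃[ i ] Joins (lookup M i) u v.
  Joins : Edge G → Fin (n G) → Fin (n G) → Set
  Joins e u v = (fst {G} e ≡ u × snd {G} e ≡ v) ⊎ (fst {G} e ≡ v × snd {G} e ≡ u)

  Joins⇒∈ₑ : ∀ e {u v} → Joins e u v → _∈ₑ_ {G} u e
  Joins⇒∈ₑ _ (inj₁ (refl , _)) = inj₁ refl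
  Joins⇒∈ₑ _ (inj₂ (_ , refl)) = inj₂ refl

  InM⇒Covers : ∀ {M u v} → InM {G} M u v → Covers M u
  InM⇒Covers {M} (i , joins) = Covered⇒Covers {M} (i , Joins⇒∈ₑ (lookup M i) joins)

  same-ends-∈ₑ : ∀ e f {x} → Joins e (fst {G} f) (snd {G} f) → _∈ₑ_ {G} x f → _∈ₑ_ {G} x e
  same-ends-∈ₑ _ _ (inj₁ (p , _)) (inj₁ x≡) = inj₁ (trans x≡ (sym p))
  same-ends-∈ₑ _ _ (inj₁ (_ , q)) (inj₂ x≡) = inj₂ (trans x≡ (sym q))
  same-ends-∈ₑ _ _ (inj₂ (_ , q)) (inj₁ x≡) = inj₂ (trans x≡ (sym q))
  same-ends-∈ₑ _ _ (inj₂ (p , _)) (inj₂ x≡) = inj₁ (trans x≡ (sym p))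

  same-ends-Joins : ∀ e f {u v} → Joins e (fst {G} f) (snd {G} f) → Joins e u v → Joins f u v
  same-ends-Joins _ _ (inj₁ (p , q)) (inj₁ (r , s)) = inj₁ (trans (sym p) r , trans (sym q) s)
  same-ends-Joins _ _ (inj₁ (p , q)) (inj₂ (r , s)) = inj₂ (trans (sym p) r , trans (sym q) s)
  same-ends-Joins _ _ (inj₂ (p , q)) (inj₁ (r , s)) = inj₂ (trans (sym q) s , trans (sym p) r)
  same-ends-Joins _ _ (inj₂ (p , q)) (inj₂ (r , s)) = inj₁ (trans (sym q) s , trans (sym p) r)

  covered-endpoint : ∀ {S} → IsVertexCover G S → (e : Edge G) → ∃[ y ] (_∈ₑ_ {G} y e × S y)
  covered-endpoint cover (a , b , ab) =
    Sum.[ (λ a∈S → a , inj₁ refl , a∈S) , (λ b∈S → b , inj₂ refl , b∈S) ] (cover ab)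

  IsMaximalMatching⇒IsVertexCover : ∀ {M} → IsMaximalMatching G M → IsVertexCover G (Covers M)
  IsMaximalMatching⇒IsVertexCover {M} (matching , maximal) {a} {b} ab
    with covers? M a | covers? M b
  ... | yes a∈V | _       = inj₁ a∈V
  ... | no _    | yes b∈V = inj₂ b∈V
  ... | no a∉V  | no b∉V  = ⊥-elim (a∉V (InM⇒Covers {M} ab∈M))
    where
    e : Edge G
    e = a , b , ab
    e#f : ∀ {f} → f ∈ M → Disjoint e f
    e#f f∈M x (inj₁ refl) x∈f = a∉V (lose f∈M x∈f)
    e#f f∈M x (inj₂ refl) x∈f = b∉V (lose f∈M x∈f)
    ab∈M : InM {G} M a b
    ab∈M = maximal (e ∷ M) (AllPairs⇒IsMatching (All.tabulate e#f ∷ IsMatching⇒AllPairs matching))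
                   (λ { _ _ (i , joins) → suc i , joins }) a b (zero , inj₁ (refl , refl))

  IsVertexCover⇒IsMaximalMatching : ∀ {M} → IsMatching G M → IsVertexCover G (Covers M) →
    IsMaximalMatching G M
  IsVertexCover⇒IsMaximalMatching {M} matching cover = matching , M′⊆M
    where
    -- An edge of M′ has an endpoint on some f ∈ M ⊆ M′; as M′ is a matching, that edge is f.
    M′⊆M : ∀ M′ → IsMatching G M′ → (∀ u v → InM {G} M u v → InM {G} M′ u v) →
           ∀ u v → InM {G} M′ u v → InM {G} M u v
    M′⊆M M′ matching′ M⊆M′ u v (i , e≈uv) with covered-endpoint cover (lookup M′ i)
    ... | y , y∈e , y∈V with Covers⇒Covered y∈V
    ... | j , y∈f with M⊆M′ _ _ (j , inj₁ (refl , refl))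
    ... | k , g≈f
      with refl ← shared-endpoint⇒same-index {M′} matching′ {i} {k} y∈e
                    (same-ends-∈ₑ (lookup M′ k) (lookup M j) g≈f y∈f)
      = j , same-ends-Joins (lookup M′ i) (lookup M j) g≈f e≈uv

length-concat-tabulate : ∀ {A : Set} {m L} (f : Fin m → List A) → (∀ i → length (f i) ≡ L) →
  length (concat (tabulate f)) ≡ m * L
length-concat-tabulate {m = zero}  f |f|≡L = refl
length-concat-tabulate {m = suc m} f |f|≡L =
  trans (length-++ (f zero))
        (cong₂ _+_ (|f|≡L zero) (length-concat-tabulate (f ∘ suc) (|f|≡L ∘ suc)))

module _ {H B : Graph} where

  liftEdge : Fin (n B) → Edge H → Edge (H □ B)
  liftEdge v (u , u′ , uu′) = combine u v , combine u′ v , inH v uu′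

  ∈-liftEdge⁺ : ∀ {u v} e → _∈ₑ_ {H} u e → _∈ₑ_ {H □ B} (combine u v) (liftEdge v e)
  ∈-liftEdge⁺ (_ , _ , _) (inj₁ refl) = inj₁ refl
  ∈-liftEdge⁺ (_ , _ , _) (inj₂ refl) = inj₂ refl

  ∈-liftEdge⁻ : ∀ {x v} e → _∈ₑ_ {H □ B} x (liftEdge v e) → ∃[ u ] (x ≡ combine u v × _∈ₑ_ {H} u e)
  ∈-liftEdge⁻ (u , _  , _) (inj₁ refl) = u  , refl , inj₁ refl
  ∈-liftEdge⁻ (_ , u′ , _) (inj₂ refl) = u′ , refl , inj₂ refl

  liftEdge-Disjoint : ∀ {v e f} → Disjoint {H} e f → Disjoint {H □ B} (liftEdge v e) (liftEdge v f)
  liftEdge-Disjoint {v} {e} {f} e#f x x∈e x∈f with ∈-liftEdge⁻ e x∈e | ∈-liftEdge⁻ f x∈f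
  ... | u , refl , u∈e | u′ , uv≡u′v , u′∈f
    with refl ← proj₁ (combine-injective u v u′ v uv≡u′v) = e#f u u∈e u′∈f

  liftEdge-apart : ∀ {v v′ e f} → v ≢ v′ → Disjoint {H □ B} (liftEdge v e) (liftEdge v′ f)
  liftEdge-apart {v} {v′} {e} {f} v≢v′ x x∈e x∈f with ∈-liftEdge⁻ e x∈e | ∈-liftEdge⁻ f x∈f
  ... | u , refl , _ | u′ , uv≡u′v′ , _ = v≢v′ (proj₂ (combine-injective u v u′ v′ uv≡u′v′))

  stack : (Fin (n B) → List (Edge H)) → List (Edge (H □ B))
  stack N = concat (tabulate (λ v → map (liftEdge v) (N v)))

  stack-isMatching : ∀ N → (∀ v → IsMatching H (N v)) → IsMatching (H □ B) (stack N)
  stack-isMatching N matching =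
    AllPairs⇒IsMatching (AllPairs.concat⁺ (All.tabulate⁺ within) (AllPairs.tabulate⁺ across))
    where
    within : ∀ v → AllPairs Disjoint (map (liftEdge v) (N v))
    within v = AllPairs.map⁺ (AllPairs.map (λ {e f} → liftEdge-Disjoint {v} {e} {f})
                                        (IsMatching⇒AllPairs {H} {N v} (matching v)))
    across : ∀ {v v′} → v ≢ v′ →
      All (λ e → All (Disjoint e) (map (liftEdge v′) (N v′))) (map (liftEdge v) (N v))
    across v≢v′ = All.map⁺ (All.universal (λ e →
      All.map⁺ (All.universal (λ f → liftEdge-apart {e = e} {f} v≢v′) _)) _)

  stack-covers : ∀ N {u v} → Covers {H} (N v) u → Covers {H □ B} (stack N) (combine u v)
  stack-covers N {v = v} u∈V =
    Any.concat⁺ (Any.tabulate⁺ v (Any.map⁺ (Any.map (λ {e} → ∈-liftEdge⁺ e) u∈V)))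

  stack-isVertexCover : ∀ N → (∀ v → IsVertexCover H (Covers (N v))) →
    (∀ {v v′} → Adj B v v′ → ∀ u → Covers (N v) u ⊎ Covers (N v′) u) →
    IsVertexCover (H □ B) (Covers (stack N))
  stack-isVertexCover N coverH coverB (inB u vv′) =
    Sum.map (stack-covers N) (stack-covers N) (coverB vv′ u)
  stack-isVertexCover N coverH coverB (inH v uu′) =
    Sum.map (stack-covers N) (stack-covers N) (coverH v uu′)

  stack-isMaximalMatching : ∀ N → (∀ v → IsMaximalMatching H (N v)) →
    (∀ {v v′} → Adj B v v′ → ∀ u → Covers (N v) u ⊎ Covers (N v′) u) →
    IsMaximalMatching (H □ B) (stack N)
  stack-isMaximalMatching N maximal coverB = IsVertexCover⇒IsMaximalMatching
    (stack-isMatching N (proj₁ ∘ maximal))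
    (stack-isVertexCover N (λ v → IsMaximalMatching⇒IsVertexCover (maximal v)) coverB)

  length-stack : ∀ N {L} → (∀ v → length (N v) ≡ L) → length (stack N) ≡ L * n B
  length-stack N {L} |N|≡L =
    trans (length-concat-tabulate _ (λ v → trans (length-map (liftEdge v) (N v)) (|N|≡L v)))
          (*-comm (n B) L)

module _ {A : Set} (P : A → Set) {x y : A} where

  if-preserves : ∀ b → P x → P y → P (if b then x else y)
  if-preserves true  px _  = px
  if-preserves false _  py = py

  if-complement-⊎ : ∀ b → P x ⊎ P y → P (if b then x else y) ⊎ P (if b then y else x)
  if-complement-⊎ true  = id
  if-complement-⊎ false = Sum.swap

  if-≢-⊎ : ∀ {b b′} → b ≢ b′ → P x ⊎ P y → P (if b then x else y) ⊎ P (if b′ then x else y)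
  if-≢-⊎ {true}  {false} _     = id
  if-≢-⊎ {false} {true}  _     = Sum.swap
  if-≢-⊎ {true}  {true}  b≢b′ = ⊥-elim (b≢b′ refl)
  if-≢-⊎ {false} {false} b≢b′ = ⊥-elim (b≢b′ refl)

module _ {H B : Graph} (c : Fin (n B) → Bool) where

  checkerboard : List (Edge H) → List (Edge H) → List (Edge (H □ B))
  checkerboard X Y = stack (λ v → if c v then X else Y)

  checkerboard-isMaximalMatching : (∀ {v v′} → Adj B v v′ → c v ≢ c v′) →
    ∀ {X Y} → IsMaximalMatching H X → IsMaximalMatching H Y → (∀ u → Covers X u ⊎ Covers Y u) →
    IsMaximalMatching (H □ B) (checkerboard X Y)
  checkerboard-isMaximalMatching proper {X} {Y} maxX maxY cover =
    stack-isMaximalMatching _ (λ v → if-preserves (IsMaximalMatching H) (c v) maxX maxY)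
                              (λ vv′ u → if-≢-⊎ (λ Z → Covers Z u) (proper vv′) (cover u))

  length-checkerboard : ∀ {X Y L} → length X ≡ L → length Y ≡ L → length (checkerboard X Y) ≡ L * n B
  length-checkerboard {L = L} |X|≡L |Y|≡L =
    length-stack _ (λ v → if-preserves (λ Z → length Z ≡ L) (c v) |X|≡L |Y|≡L)

  checkerboard-covers : ∀ {X Y} → (∀ u → Covers X u ⊎ Covers Y u) →
    ∀ x → Covers (checkerboard X Y) x ⊎ Covers (checkerboard Y X) x
  checkerboard-covers {X} {Y} cover x =
    subst CoveredByOne (combine-remQuot {n H} (n B) x) (at (remQuot {n H} (n B) x))
    where
    CoveredByOne : Fin (n H * n B) → Set
    CoveredByOne z = Covers (checkerboard X Y) z ⊎ Covers (checkerboard Y X) z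
    at : ∀ ((u , v) : Fin (n H) × Fin (n B)) → CoveredByOne (combine u v)
    at (u , v) =
      Sum.map (stack-covers _) (stack-covers _) (if-complement-⊎ (λ Z → Covers Z u) (c v) (cover u))

proposition6p3 : (H B : Graph) → IsSimple H → IsSimple B → IsBipartite B →
    (N● N○ : List (Edge H)) → IsMaximalMatching H N● → IsMaximalMatching H N○ →
    length N● ≡ length N○ →
    (∀ x → Covered {H} N● x ⊎ Covered {H} N○ x) →
    Σ (List (Edge (H □ B))) λ M● → Σ (List (Edge (H □ B))) λ M○ →
    IsMaximalMatching (H □ B) M● × IsMaximalMatching (H □ B) M○ ×
    length M● ≡ length N● * n B × length M○ ≡ length N● * n B ×
    (∀ x → Covered {H □ B} M● x ⊎ Covered {H □ B} M○ x)
proposition6p3 H B _ _ (c , proper) N● N○ max● max○ |N●|≡|N○| cover =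
    checkerboard c N● N○ , checkerboard c N○ N●
  , checkerboard-isMaximalMatching c proper max● max○ cover′
  , checkerboard-isMaximalMatching c proper max○ max● (Sum.swap ∘ cover′)
  , length-checkerboard c refl (sym |N●|≡|N○|)
  , length-checkerboard c (sym |N●|≡|N○|) refl
  , Sum.map Covers⇒Covered Covers⇒Covered ∘ checkerboard-covers c cover′
  where
  cover′ : ∀ u → Covers N● u ⊎ Covers N○ u
  cover′ = Sum.map Covered⇒Covers Covered⇒Covers ∘ cover
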